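{- Every signed graph built from $(K_3,-)$ by repeated applications of operations [1] and [2] described below admits a balanced $(83,41)$-coloring.
   Context: A signed graph $(G,\sigma)$ is a graph with a signature $\sigma:E(G)\to\{+,-\}$; a cycle is negative if it has an odd number of negative edges; a vertex set is balanced if it induces no negative cycle. A balanced $(p,q)$-coloring assigns to each vertex a set of $q$ colors from $\{1,\dots,p\}$ so that each color class is balanced. $(K_n,-)$ denotes $K_n$ with all edges negative. Switching at a vertex multiplies the signs of all its incident edges by $-1$; two signed graphs are switching equivalent if one can be obtained from the other by a sequence of switchings. The signed graph $\widehat{W}$: vertices $u,v,w,z,t,x_1,\dots,x_5$; edges $wx_i$ ($1\le i\le5$), $x_1x_2,x_2x_3,x_3x_4,x_4x_5,x_5x_1$, $zx_2,zx_3,zu,zv$, $tx_4,tx_5,tu,tv$, $ux_1,ux_2,ux_5,uv$, $vx_3,vx_4$; the edges $ux_2$ and $vx_4$ are positive and all others negative. The signed graph $\widehat{W}'$ is obtained from $\widehat{W}$ by adding vertices $a_1,a_2,a_3,b_1,b_2,b_3$ with negative edges $a_1a_2,a_2a_3,a_1a_3,a_1x_1,a_1x_2,a_2u$, positive edges $a_2x_2,a_3u,a_3x_1$, negative edges $b_1b_2,b_2b_3,b_1b_3,b_1x_3,b_1x_4,b_2v$ and positive edges $b_2x_4,b_3v,b_3x_3$. The graphs are built as plane signed graphs starting from $(K_3,-)$, using: [1] Insert a new vertex inside a facial negative triangle, join it to the three vertices of the triangle, and assign signs to the three new edges so that the resulting signed $K_4$ is switching equivalent to $(K_4,-)$. [2]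 Given an edge $xy$ of a previously built signed graph, add a copy of $\widehat{W}'$ with its edge $uv$ identified with $xy$ (switching the copy if needed so that the sign of $uv$ agrees with that of $xy$). -}

module Defs where

open import Data.Nat using (ℕ; zero; suc; _+_; _≤_)
open import Data.Fin using (Fin; zero; suc; inject₁; fromℕ; _↑ˡ_; _↑ʳ_; #_)
open import Data.Fin.Subset using (Subset; ∣_∣) renaming (_∈_ to _∈ₛ_)
open import Data.List using (List; []; _∷_; _++_; [_]; map; length; _∷ʳ_)
open import Data.List.Membership.Propositional using (_∈_)
open import Data.List.Relation.Unary.All using (All)
open import Data.List.Relation.Unary.Unique.Propositional using (Unique)
open import Data.List.Relation.Binary.Permutation.Propositional using (_↭_)
open import Data.Product using (Σ; _×_; _,_; ∃)
open import Data.Sum using (_⊎_)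
open import Data.Empty using (⊥)
open import Relation.Binary.PropositionalEquality using (_≡_)

data Sign : Set where
  pos neg : Sign

_·_ : Sign → Sign → Sign
pos · s = s
neg · pos = neg
neg · neg = pos

infixl 7 _·_

-- Signed graphs on the vertex set Fin n, given by a list of signed edges
-- (a , b , σ(ab)); edges are undirected.

SG : ℕ → Set
SG n = List (Fin n × Fin n × Sign)

SEdge : ∀ {n} → SG n → Fin n → Fin n → Sign → Set
SEdge G a b s = (a , b , s) ∈ G ⊎ (b , a , s) ∈ G

data SWalk {n} (G : SG n) : List (Fin n) → Sign → Set where
  single : ∀ v → SWalk G (v ∷ []) pos
  step   : ∀ {v w vs s t} → SEdge G v w t → SWalk G (w ∷ vs) s →
           SWalk G (v ∷ w ∷ vs) (t · s)

Cycle : ∀ {n} → SG n → List (Fin n) → Sign → Set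
Cycle G [] s = ⊥
Cycle G (v ∷ vs) s =
  3 ≤ length (v ∷ vs) × Unique (v ∷ vs) × SWalk G ((v ∷ vs) ∷ʳ v) s

NegCycle : ∀ {n} → SG n → List (Fin n) → Set
NegCycle G vs = Cycle G vs neg

Balanced : ∀ {n} → SG n → (Fin n → Set) → Set
Balanced G X = ∀ vs → NegCycle G vs → All X vs → ⊥

-- balanced (p,q)-coloring: each vertex gets a q-subset of {1..p}
-- (here Fin p), and every color class is balanced
BalancedColoring : ℕ → ℕ → ∀ {n} → SG n → Set
BalancedColoring p q {n} G =
  Σ (Fin n → Subset p) λ c →
    (∀ v → ∣ c v ∣ ≡ q) × (∀ (k : Fin p) → Balanced G (λ v → k ∈ₛ c v))

data WV : Set where
  u v w z t x1 x2 x3 x4 x5 a1 a2 a3 b1 b2 b3 : WV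

-- all edges of Ŵ' except uv, with their signs
W'edges : List (WV × WV × Sign)
W'edges =
  (w , x1 , neg) ∷ (w , x2 , neg) ∷ (w , x3 , neg) ∷ (w , x4 , neg) ∷ (w , x5 , neg) ∷
  (x1 , x2 , neg) ∷ (x2 , x3 , neg) ∷ (x3 , x4 , neg) ∷ (x4 , x5 , neg) ∷ (x5 , x1 , neg) ∷
  (z , x2 , neg) ∷ (z , x3 , neg) ∷ (z , u , neg) ∷ (z , v , neg) ∷
  (t , x4 , neg) ∷ (t , x5 , neg) ∷ (t , u , neg) ∷ (t , v , neg) ∷
  (u , x1 , neg) ∷ (u , x2 , pos) ∷ (u , x5 , neg) ∷
  (v , x3 , neg) ∷ (v , x4 , pos) ∷
  (a1 , a2 , neg) ∷ (a2 , a3 , neg) ∷ (a1 , a3 , neg) ∷ (a1 , x1 , neg) ∷ (a1 , x2 , neg) ∷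
  (a2 , u , neg) ∷ (a2 , x2 , pos) ∷ (a3 , u , pos) ∷ (a3 , x1 , pos) ∷
  (b1 , b2 , neg) ∷ (b2 , b3 , neg) ∷ (b1 , b3 , neg) ∷ (b1 , x3 , neg) ∷ (b1 , x4 , neg) ∷
  (b2 , v , neg) ∷ (b2 , x4 , pos) ∷ (b3 , v , pos) ∷ (b3 , x3 , pos) ∷ []

σuv : Sign
σuv = neg

-- faces of the (essentially unique) plane embedding of Ŵ', except the two
-- faces u z v and u t v that contain the edge uv
W'innerFaces : List (List WV)
W'innerFaces =
  (w ∷ x1 ∷ x2 ∷ []) ∷ (w ∷ x2 ∷ x3 ∷ []) ∷ (w ∷ x3 ∷ x4 ∷ []) ∷
  (w ∷ x4 ∷ x5 ∷ []) ∷ (w ∷ x5 ∷ x1 ∷ []) ∷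
  -- around the wheel (face u x1 x2 is filled by the a-octahedron,
  -- face v x3 x4 by the b-octahedron)
  (u ∷ x5 ∷ x1 ∷ []) ∷ (u ∷ x2 ∷ z ∷ []) ∷ (z ∷ x2 ∷ x3 ∷ []) ∷
  (z ∷ x3 ∷ v ∷ []) ∷ (v ∷ x4 ∷ t ∷ []) ∷ (t ∷ x4 ∷ x5 ∷ []) ∷ (t ∷ x5 ∷ u ∷ []) ∷
  (u ∷ x1 ∷ a3 ∷ []) ∷ (u ∷ a2 ∷ x2 ∷ []) ∷ (u ∷ a2 ∷ a3 ∷ []) ∷
  (a1 ∷ x1 ∷ x2 ∷ []) ∷ (a1 ∷ x1 ∷ a3 ∷ []) ∷ (a1 ∷ a2 ∷ x2 ∷ []) ∷
  (a1 ∷ a2 ∷ a3 ∷ []) ∷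
  (v ∷ x3 ∷ b3 ∷ []) ∷ (v ∷ b2 ∷ x4 ∷ []) ∷ (v ∷ b2 ∷ b3 ∷ []) ∷
  (b1 ∷ x3 ∷ x4 ∷ []) ∷ (b1 ∷ x3 ∷ b3 ∷ []) ∷ (b1 ∷ b2 ∷ x4 ∷ []) ∷
  (b1 ∷ b2 ∷ b3 ∷ []) ∷ []

-- which of the two faces through uv (u z v or u t v) becomes the outer face
-- of the copy; returns (outer vertex , the other, still internal, vertex)
data Side : Set where
  outerT outerZ : Side

outerV : Side → WV
outerV outerT = t
outerV outerZ = z

innerV : Side → WV
innerV outerT = z
innerV outerZ = t

newIx : WV → Fin 14
newIx u  = zero    -- unused (u is identified with an old vertex)
newIx v  = zero    -- unused
newIx w  = # 0
newIx z  = # 1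
newIx t  = # 2
newIx x1 = # 3
newIx x2 = # 4
newIx x3 = # 5
newIx x4 = # 6
newIx x5 = # 7
newIx a1 = # 8
newIx a2 = # 9
newIx a3 = # 10
newIx b1 = # 11
newIx b2 = # 12
newIx b3 = # 13

embed : ∀ {n} → Fin n → Fin n → WV → Fin (n + 14)
embed p q u = p ↑ˡ 14
embed p q v = q ↑ˡ 14
embed {n} p q y = n ↑ʳ newIx y

liftSG : ∀ {n} m → SG n → SG (n + m)
liftSG m = map (λ { (a , b , s) → (a ↑ˡ m , b ↑ˡ m , s) })

liftFaces : ∀ {n} m → List (List (Fin n)) → List (List (Fin (n + m)))
liftFaces m = map (map (_↑ˡ m))

copyEdges : ∀ {n} → Fin n → Fin n → (WV → Sign) → SG (n + 14)
copyEdges p q sw =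
  map (λ { (a , b , s) → (embed p q a , embed p q b , sw a · s · sw b) }) W'edges

-- Built n G Fs : G (on vertices Fin n) is built, and Fs is the list of
-- faces of its plane embedding, each given as its cyclic boundary sequence.

K3 : SG 3
K3 = (# 0 , # 1 , neg) ∷ (# 1 , # 2 , neg) ∷ (# 0 , # 2 , neg) ∷ []

data Built : (n : ℕ) → SG n → List (List (Fin n)) → Set where
  -- (K₃,-) in the plane: two triangular faces (inside and outside)
  base : Built 3 K3 ((# 0 ∷ # 1 ∷ # 2 ∷ []) ∷ (# 0 ∷ # 2 ∷ # 1 ∷ []) ∷ [])
  -- bookkeeping: the face list is unordered, faces are cyclic sequences
  perm : ∀ {n G Fs Fs'} → Built n G Fs → Fs ↭ Fs' → Built n G Fs'
  rot  : ∀ {n G a F Fs} → Built n G ((a ∷ F) ∷ Fs) → Built n G ((F ∷ʳ a) ∷ Fs)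
  -- operation [1]: inside the facial triangle x y z (which must be negative,
  -- as implied by the switching condition) insert a new vertex n' adjacent to
  -- x, y, z, with signs making the K₄ switching equivalent to (K₄,-), i.e.
  -- there are switching values sx sy sz sn with every K₄ edge of sign
  -- neg · (switch at its ends)
  op1 : ∀ {n G Fs x y z} (sx sy sz sn : Sign) →
        Built n G ((x ∷ y ∷ z ∷ []) ∷ Fs) →
        NegCycle G (x ∷ y ∷ z ∷ []) →
        SEdge G x y (sx · neg · sy) →
        SEdge G y z (sy · neg · sz) →
        SEdge G x z (sx · neg · sz) →
        let n' = fromℕ n in
        Built (suc n)
          ((n' , inject₁ x , sn · neg · sx) ∷ (n' , inject₁ y , sn · neg · sy) ∷
           (n' , inject₁ z , sn · neg · sz) ∷
           map (λ { (a , b , s) → (inject₁ a , inject₁ b , s) }) G)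
          ((inject₁ x ∷ inject₁ y ∷ n' ∷ []) ∷ (inject₁ y ∷ inject₁ z ∷ n' ∷ []) ∷
           (inject₁ z ∷ inject₁ x ∷ n' ∷ []) ∷
           map (map inject₁) Fs)
  -- operation [2]: the edge ab lies on the face (a b rest…); put a copy of
  -- Ŵ' inside this face, with uv identified with ab (u ↦ p, v ↦ q where
  -- {p,q} = {a,b} in either order), the copy switched by sw so that the
  -- sign of uv agrees with that of ab; one of the faces u z v / u t v of the
  -- copy merges with the host face, all other faces of the copy are new faces
  op2 : ∀ {n G Fs a b rest σab} (p q : Fin n) (side : Side) (sw : WV → Sign) →
        Built n G ((a ∷ b ∷ rest) ∷ Fs) →
        SEdge G a b σab →
        (p ≡ a × q ≡ b) ⊎ (p ≡ b × q ≡ a) →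
        sw u · σuv · sw v ≡ σab →
        Built (n + 14)
          (copyEdges p q sw ++ liftSG 14 G)
          (((a ↑ˡ 14) ∷ embed p q (outerV side) ∷ (b ↑ˡ 14) ∷ map (_↑ˡ 14) rest) ∷
           map (map (embed p q)) ((u ∷ innerV side ∷ v ∷ []) ∷ W'innerFaces) ++
           liftFaces 14 Fs)

module Submission where

open import Defs
open import Data.Bool using (Bool; true; false; _∧_; not; if_then_else_; T)
open import Data.Bool.Properties using (∧-zeroʳ; ∧-comm)
open import Data.Empty using (⊥-elim)
open import Data.Fin using (Fin; zero; suc; toℕ; inject₁; fromℕ; _↑ˡ_; _↑ʳ_; splitAt)
open import Data.Fin.Patterns using (0F; 1F; 2F)
open import Data.Fin.Properties using (splitAt-↑ˡ; splitAt-↑ʳ) renaming (all? to allFin?)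
open import Data.Fin.Subset using (∣_∣) renaming (_∈_ to _∈ₛ_)
open import Data.List using (List; []; _∷_; _++_; [_]; length; map; foldl; concatMap; replicate)
open import Data.List.Membership.Propositional using (_∈_)
open import Data.List.Properties using (foldl-++; map-cong)
open import Data.List.Relation.Unary.All as All using (All; []; _∷_)
open import Data.List.Relation.Unary.All.Properties using (map⁺; ++⁺)
open import Data.List.Relation.Unary.Any using (here; there)
open import Data.Maybe using (Maybe; just; nothing; is-just; fromMaybe; _<∣>_)
import Data.Maybe as Maybe
open import Data.Maybe.Properties using (≡-dec)
open import Data.Nat using (ℕ; zero; suc; _+_; _*_; _∸_; _⊓_; _≤ᵇ_; _<ᵇ_; _≟_)
open import Data.Nat.ListAction using (sum)
open import Data.Nat.Properties
  using (+-identityʳ; m+n∸m≡n; m+n∸n≡m; suc-injective; ⊓-zeroʳ; 0≢1+n; +-0-commutativeMonoid)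
open import Algebra.Properties.CommutativeMonoid.Sum +-0-commutativeMonoid
  using (sum-syntax; sum-cong-≗; ∑-distrib-+; sum-replicate-zero)
open import Data.Product using (Σ; _×_; _,_; proj₁; proj₂; uncurry)
open import Data.Sum using (_⊎_; inj₁; inj₂; [_,_]′)
open import Data.Unit using (⊤; tt)
open import Data.Vec using ([]; _∷_; tabulate; lookup)
open import Data.Vec.Properties using (lookup∘tabulate; []=⇒lookup)
open import Function using (_∘_)
open import Relation.Binary.Definitions using (DecidableEquality)
open import Relation.Binary.PropositionalEquality
  using (_≡_; _≗_; refl; sym; trans; cong; cong₂; cong-app; subst; subst₂; module ≡-Reasoning)
open import Relation.Nullary using (Dec; yes; no; ¬_)
open import Relation.Nullary.Decidable using (True; toWitness; _×-dec_)

open ≡-Reasoning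

-- The proof keeps a stronger invariant.  Every vertex carries 41 of the 83 colours, each
-- together with a sign by which the vertex is switched in that colour class, such that along
-- every edge ab of sign σ each common colour has signs sₐ, s_b with sₐ s_b = σ, and a and b
-- share 12, 13 or 14 colours.  Such signs witness that every colour class is balanced.
--
-- (K₃,-) has such a colouring.  For operation [1] in a negative triangle xyz, no colour lies
-- on all three vertices (that class would contain a negative triangle), so counting gives
-- the sizes of the seven regions of the colours of x, y, z; the new vertex takes up to 14
-- colours private to x, up to 14 private to y, all free colours, and fills up with colours
-- private to z, with the sign each of them forces.  For operation [2] on an edge pq, the
-- colours fall into four classes by presence at p and q, and for each of the three
-- possible overlaps an explicit table colours the copy of Ŵ' class by class.

·-comm : ∀ a b → a · b ≡ b · a
·-comm pos pos = refl
·-comm pos neg = refl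
·-comm neg pos = refl
·-comm neg neg = refl

·-assoc : ∀ a b c → a · b · c ≡ a · (b · c)
·-assoc pos b   c   = refl
·-assoc neg pos c   = refl
·-assoc neg neg pos = refl
·-assoc neg neg neg = refl

·-identityʳ : ∀ a → a · pos ≡ a
·-identityʳ pos = refl
·-identityʳ neg = refl

·-inverse : ∀ a → a · a ≡ pos
·-inverse pos = refl
·-inverse neg = refl

·-cancelˡ : ∀ a b → a · (a · b) ≡ b
·-cancelˡ a b = trans (sym (·-assoc a a b)) (cong (_· b) (·-inverse a))

·-cancelʳ : ∀ a b → a · b · b ≡ a
·-cancelʳ a b = trans (·-assoc a b b) (trans (cong (a ·_) (·-inverse b)) (·-identityʳ a))

·-interchange : ∀ a b c d → (a · b) · (c · d) ≡ a · (b · d) · c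
·-interchange a b c d = begin
  a · b · (c · d)   ≡⟨ ·-assoc a b (c · d) ⟩
  a · (b · (c · d)) ≡⟨ cong (a ·_) (sym (·-assoc b c d)) ⟩
  a · (b · c · d)   ≡⟨ cong (λ s → a · (s · d)) (·-comm b c) ⟩
  a · (c · b · d)   ≡⟨ cong (a ·_) (·-assoc c b d) ⟩
  a · (c · (b · d)) ≡⟨ cong (a ·_) (·-comm c (b · d)) ⟩
  a · (b · d · c)   ≡⟨ sym (·-assoc a (b · d) c) ⟩
  a · (b · d) · c   ∎

·-conjugate : ∀ r s → r · s · r ≡ s
·-conjugate r s = trans (cong (_· r) (·-comm r s)) (·-cancelʳ s r)

switch-back : ∀ e a → e · (e · a · pos) ≡ a
switch-back e a = trans (cong (e ·_) (·-identityʳ (e · a))) (·-cancelˡ e a)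

·-shuffle : ∀ e₁ e₂ a → e₂ · (e₁ · a · neg) ≡ a · (e₁ · neg · e₂)
·-shuffle pos pos pos = refl
·-shuffle pos pos neg = refl
·-shuffle pos neg pos = refl
·-shuffle pos neg neg = refl
·-shuffle neg pos pos = refl
·-shuffle neg pos neg = refl
·-shuffle neg neg pos = refl
·-shuffle neg neg neg = refl

infix 4 _≟ˢ_
_≟ˢ_ : DecidableEquality Sign
pos ≟ˢ pos = yes refl
pos ≟ˢ neg = no λ ()
neg ≟ˢ pos = no λ ()
neg ≟ˢ neg = yes refl

fromBool : Bool → ℕ
fromBool true  = 1
fromBool false = 0

count : ∀ {n} → (Fin n → Bool) → ℕ
count {n} P = ∑[ k < n ] fromBool (P k)

count-cong : ∀ {n} {P Q : Fin n → Bool} → P ≗ Q → count P ≡ count Q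
count-cong P≗Q = sum-cong-≗ (cong fromBool ∘ P≗Q)

count-∑ : ∀ {n} (P : Fin n → Bool) (Ps : List (Fin n → Bool)) →
          (∀ k → fromBool (P k) ≡ sum (map (λ Q → fromBool (Q k)) Ps)) →
          count P ≡ sum (map count Ps)
count-∑ {n} P Ps split = trans (sum-cong-≗ split) (exchange Ps)
  where
  exchange : ∀ Qs → ∑[ k < n ] sum (map (λ Q → fromBool (Q k)) Qs) ≡ sum (map count Qs)
  exchange []       = sum-replicate-zero n
  exchange (Q ∷ Qs) = trans (∑-distrib-+ (fromBool ∘ Q) _) (cong (count Q +_) (exchange Qs))

takeFirst : ∀ {n} → ℕ → (Fin n → Bool) → Fin n → Bool
takeFirst zero    P k       = false
takeFirst (suc m) P zero    = P zero
takeFirst (suc m) P (suc k) = takeFirst (if P zero then m else suc m) (P ∘ suc) k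

count-takeFirst : ∀ {n} m (P : Fin n → Bool) → count (λ k → P k ∧ takeFirst m P k) ≡ m ⊓ count P
count-takeFirst {zero}  m       P = sym (⊓-zeroʳ m)
count-takeFirst {suc n} zero    P = trans (count-cong (∧-zeroʳ ∘ P)) (sum-replicate-zero (suc n))
count-takeFirst {suc n} (suc m) P with P zero
... | true  = cong suc (count-takeFirst m (P ∘ suc))
... | false = count-takeFirst (suc m) (P ∘ suc)

countᴸ : {A : Set} → (A → Bool) → List A → ℕ
countᴸ F xs = sum (map (fromBool ∘ F) xs)

-- allocate R d xs hands out the elements of xs, in order, to the positions where R holds;
-- the value d, and the values at positions outside R, are junk.
allocate : ∀ {n} {A : Set} → (Fin n → Bool) → A → List A → Fin n → A
allocate R d []       k       = d
allocate R d (x ∷ xs) zero    = x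
allocate R d (x ∷ xs) (suc k) = allocate (R ∘ suc) d (if R zero then xs else x ∷ xs) k

allocate-∈ : ∀ {n} {A : Set} (R : Fin n → Bool) (d : A) xs → length xs ≡ count R →
             ∀ {k} → T (R k) → allocate R d xs k ∈ xs
allocate-∈ R d []       len {zero}  r with R zero
... | true  = ⊥-elim (0≢1+n len)
... | false = ⊥-elim r
allocate-∈ R d []       len {suc k} r with R zero
... | true  = ⊥-elim (0≢1+n len)
... | false = allocate-∈ (R ∘ suc) d [] len r
allocate-∈ R d (x ∷ xs) len {zero}  r = here refl
allocate-∈ R d (x ∷ xs) len {suc k} r with R zero
... | true  = there (allocate-∈ (R ∘ suc) d xs (suc-injective len) r)
... | false = allocate-∈ (R ∘ suc) d (x ∷ xs) len r

count-allocate : ∀ {n} {A : Set} (R : Fin n → Bool) (d : A) xs (F : A → Bool) →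
                 length xs ≡ count R → count (λ k → R k ∧ F (allocate R d xs k)) ≡ countᴸ F xs
count-allocate {zero}  R d []       F len = refl
count-allocate {suc n} R d []       F len with R zero
... | true  = ⊥-elim (0≢1+n len)
... | false = count-allocate (R ∘ suc) d [] F len
count-allocate {suc n} R d (x ∷ xs) F len = unfold (R zero) (R ∘ suc) len
  where
  -- stated in terms of R zero and R ∘ suc, so that splitting on R zero reaches inside allocate
  unfold : ∀ b (R′ : Fin n → Bool) → suc (length xs) ≡ fromBool b + count R′ →
         fromBool (b ∧ F x) + count (λ k → R′ k ∧ F (allocate R′ d (if b then xs else x ∷ xs) k))
         ≡ countᴸ F (x ∷ xs)
  unfold true  R′ len = cong (fromBool (F x) +_) (count-allocate R′ d xs F (suc-injective len))
  unfold false R′ len = count-allocate R′ d (x ∷ xs) F len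

-- The colours of a vertex, each with the sign by which the vertex is switched in that
-- colour class.
SignedSet : ℕ → Set
SignedSet p = Fin p → Maybe Sign

has : Maybe Sign → Bool
has = is-just

switch : Sign → Maybe Sign → Maybe Sign
switch e = Maybe.map (e ·_)

has-switch : ∀ e A → has (switch e A) ≡ has A
has-switch e (just a) = refl
has-switch e nothing  = refl

card : ∀ {p} → SignedSet p → ℕ
card A = count (has ∘ A)

common : ∀ {p} → SignedSet p → SignedSet p → ℕ
common A B = count (λ k → has (A k) ∧ has (B k))

Consistent : Sign → Maybe Sign → Maybe Sign → Set
Consistent σ (just a) (just b) = a · b ≡ σ
Consistent σ _        _        = ⊤

consistent? : ∀ σ A B → Dec (Consistent σ A B)
consistent? σ (just a) (just b) = a · b ≟ˢ σ
consistent? σ (just a) nothing  = yes tt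
consistent? σ nothing  B        = yes tt

Consistent-sym : ∀ σ A B → Consistent σ A B → Consistent σ B A
Consistent-sym σ (just a) (just b) ab≡σ = trans (·-comm b a) ab≡σ
Consistent-sym σ (just a) nothing  _    = tt
Consistent-sym σ nothing  (just b) _    = tt
Consistent-sym σ nothing  nothing  _    = tt

Consistent-switch : ∀ e₁ e₂ {σ} A B → Consistent σ A B →
                    Consistent (e₁ · σ · e₂) (switch e₁ A) (switch e₂ B)
Consistent-switch e₁ e₂ (just a) (just b) refl = ·-interchange e₁ a e₂ b
Consistent-switch e₁ e₂ (just a) nothing  _    = tt
Consistent-switch e₁ e₂ nothing  B        _    = tt

consistent⇒sign : ∀ {σ} A B → Consistent σ A B → T (has A) → T (has B) →
                  σ ≡ fromMaybe pos A · fromMaybe pos B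
consistent⇒sign (just a) (just b) ab≡σ _ _ = sym ab≡σ

data Overlap : ℕ → Set where
  twelve   : Overlap 12
  thirteen : Overlap 13
  fourteen : Overlap 14

overlap? : ∀ n → Dec (Overlap n)
overlap? n with n ≟ 12 | n ≟ 13 | n ≟ 14
... | yes refl | _        | _        = yes twelve
... | no _     | yes refl | _        = yes thirteen
... | no _     | no _     | yes refl = yes fourteen
... | no ≢12   | no ≢13   | no ≢14   =
  no λ { twelve → ≢12 refl ; thirteen → ≢13 refl ; fourteen → ≢14 refl }

Fits : ∀ {p} → Sign → SignedSet p → SignedSet p → Set
Fits σ A B = (∀ k → Consistent σ (A k) (B k)) × Overlap (common A B)

Fits-sym : ∀ {p σ} {A B : SignedSet p} → Fits σ A B → Fits σ B A
Fits-sym {A = A} {B} (consistent , shared) =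
  (λ k → Consistent-sym _ (A k) (B k) (consistent k)) ,
  subst Overlap (count-cong (λ k → ∧-comm (has (A k)) (has (B k)))) shared

Fits-cong : ∀ {p σ} {A A′ B B′ : SignedSet p} → A ≗ A′ → B ≗ B′ → Fits σ A B → Fits σ A′ B′
Fits-cong {σ = σ} A≗A′ B≗B′ (consistent , shared) =
  (λ k → subst₂ (Consistent σ) (A≗A′ k) (B≗B′ k) (consistent k)) ,
  subst Overlap (count-cong (λ k → cong₂ (λ a b → has a ∧ has b) (A≗A′ k) (B≗B′ k))) shared

FitsEdge : ∀ {n p} → (Fin n → SignedSet p) → Fin n × Fin n × Sign → Set
FitsEdge c (a , b , σ) = Fits σ (c a) (c b)

relabel : ∀ {m m′ p} {c : Fin m → SignedSet p} {c′ : Fin m′ → SignedSet p} (ι : Fin m → Fin m′) →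
          (∀ j → c′ (ι j) ≡ c j) → ∀ {e} → FitsEdge c e →
          FitsEdge c′ (ι (proj₁ e) , ι (proj₁ (proj₂ e)) , proj₂ (proj₂ e))
relabel ι c′∘ι≡c {a , b , σ} = subst₂ (Fits σ) (sym (c′∘ι≡c a)) (sym (c′∘ι≡c b))

record SignedColouring {n} (G : SG n) : Set where
  field
    colour  : Fin n → SignedSet 83
    card≡41 : ∀ a → card (colour a) ≡ 41
    fits    : All (FitsEdge colour) G

fits-SEdge : ∀ {n} {G : SG n} (𝒞 : SignedColouring G) {a b σ} → SEdge G a b σ →
             Fits σ (SignedColouring.colour 𝒞 a) (SignedColouring.colour 𝒞 b)
fits-SEdge 𝒞 (inj₁ ab∈G) = All.lookup (SignedColouring.fits 𝒞) ab∈G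
fits-SEdge 𝒞 (inj₂ ba∈G) = Fits-sym (All.lookup (SignedColouring.fits 𝒞) ba∈G)

module _ {n} {G : SG n} (X : Fin n → Set) (s : Fin n → Sign)
         (switched : ∀ {a b σ} → SEdge G a b σ → X a → X b → σ ≡ s a · s b) where

  walk-sign : ∀ {a vs σ} → SWalk G (a ∷ vs) σ → All X (a ∷ vs) →
              σ ≡ s a · s (foldl (λ _ b → b) a vs)
  walk-sign {a} (single a) _ = sym (·-inverse (s a))
  walk-sign {a} {b ∷ vs} (step {t = τ} ab rest) (xa ∷ xbs@(xb ∷ _)) = begin
    τ · _                     ≡⟨ cong₂ _·_ (switched ab xa xb) (walk-sign rest xbs) ⟩
    s a · s b · (s b · s l)   ≡⟨ ·-assoc (s a) (s b) (s b · s l) ⟩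
    s a · (s b · (s b · s l)) ≡⟨ cong (s a ·_) (·-cancelˡ (s b) (s l)) ⟩
    s a · s l                 ∎
    where l = foldl (λ _ c → c) b vs

  switching⇒balanced : Balanced G X
  switching⇒balanced (a ∷ vs) (_ , _ , closed) xs@(xa ∷ _) = neg≢pos (begin
    neg                                        ≡⟨ walk-sign closed (++⁺ xs (xa ∷ [])) ⟩
    s a · s (foldl (λ _ b → b) a (vs ++ [ a ]))
      ≡⟨ cong (λ b → s a · s b) (foldl-++ (λ _ b → b) a vs [ a ]) ⟩
    s a · s a                                  ≡⟨ ·-inverse (s a) ⟩
    pos                                        ∎)
    where
    neg≢pos : ¬ neg ≡ pos
    neg≢pos ()

module _ {n} {G : SG n} (𝒞 : SignedColouring G) where
  open SignedColouring 𝒞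

  colourClass-balanced : ∀ k → Balanced G (λ a → T (has (colour a k)))
  colourClass-balanced k = switching⇒balanced _ (λ a → fromMaybe pos (colour a k))
    λ {a} {b} ab xa xb → consistent⇒sign (colour a k) (colour b k) (proj₁ (fits-SEdge 𝒞 ab) k) xa xb

∣tabulate∣ : ∀ {m} (f : Fin m → Bool) → ∣ tabulate f ∣ ≡ count f
∣tabulate∣ {zero}  f = refl
∣tabulate∣ {suc m} f with f zero
... | true  = cong suc (∣tabulate∣ (f ∘ suc))
... | false = ∣tabulate∣ (f ∘ suc)

∈tabulate : ∀ {m} (f : Fin m → Bool) {k} → k ∈ₛ tabulate f → T (f k)
∈tabulate f {k} k∈ = subst T (trans (sym ([]=⇒lookup k∈)) (lookup∘tabulate f k)) tt

signedColouring⇒balancedColoring : ∀ {n} {G : SG n} → SignedColouring G → BalancedColoring 83 41 G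
signedColouring⇒balancedColoring 𝒞 =
  (λ a → tabulate (has ∘ colour a)) ,
  (λ a → trans (∣tabulate∣ (has ∘ colour a)) (card≡41 a)) ,
  λ k cycle negative members → colourClass-balanced 𝒞 k cycle negative
                                 (All.map (∈tabulate (has ∘ colour _)) members)
  where open SignedColouring 𝒞

band : ℕ → ℕ → Sign → SignedSet 83
band lo hi s k = if (lo ≤ᵇ toℕ k) ∧ (toℕ k <ᵇ hi) then just s else nothing

colourK3 : Fin 3 → SignedSet 83
colourK3 0F k = band 0 41 pos k
colourK3 1F k = band 0 14 neg k <∣> band 41 68 pos k
colourK3 2F k = band 14 28 neg k <∣> band 41 55 neg k <∣> band 68 81 pos k

consistent-everywhere : ∀ {p} σ (A B : SignedSet p) → True (allFin? (λ k → consistent? σ (A k) (B k))) →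
                        ∀ k → Consistent σ (A k) (B k)
consistent-everywhere σ A B = toWitness

signedColouringK3 : SignedColouring K3
signedColouringK3 = record
  { colour  = colourK3
  ; card≡41 = λ { 0F → refl ; 1F → refl ; 2F → refl }
  ; fits    = (consistent-everywhere neg (colourK3 0F) (colourK3 1F) tt , fourteen)
            ∷ (consistent-everywhere neg (colourK3 1F) (colourK3 2F) tt , fourteen)
            ∷ (consistent-everywhere neg (colourK3 0F) (colourK3 2F) tt , fourteen)
            ∷ []
  }

snoc : ∀ {A : Set} n → (Fin n → A) → A → Fin (suc n) → A
snoc zero    f a _       = a
snoc (suc n) f a zero    = f zero
snoc (suc n) f a (suc i) = snoc n (f ∘ suc) a i

snoc-fromℕ : ∀ {A : Set} n (f : Fin n → A) a → snoc n f a (fromℕ n) ≡ a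
snoc-fromℕ zero    f a = refl
snoc-fromℕ (suc n) f a = snoc-fromℕ n (f ∘ suc) a

snoc-inject₁ : ∀ {A : Set} n (f : Fin n → A) a j → snoc n f a (inject₁ j) ≡ f j
snoc-inject₁ (suc n) f a zero    = refl
snoc-inject₁ (suc n) f a (suc j) = snoc-inject₁ n (f ∘ suc) a j

snoc-all : ∀ {A : Set} (P : A → Set) n (f : Fin n → A) a →
           (∀ j → P (f j)) → P a → ∀ i → P (snoc n f a i)
snoc-all P zero    f a Pf Pa i       = Pa
snoc-all P (suc n) f a Pf Pa zero    = Pf zero
snoc-all P (suc n) f a Pf Pa (suc i) = snoc-all P n (f ∘ suc) a (Pf ∘ suc) Pa i

only₁ only₂ only₃ none : Maybe Sign → Maybe Sign → Maybe Sign → Bool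
only₁ A B C = has A ∧ not (has B) ∧ not (has C)
only₂ A B C = not (has A) ∧ has B ∧ not (has C)
only₃ A B C = not (has A) ∧ not (has B) ∧ has C
none  A B C = not (has A) ∧ not (has B) ∧ not (has C)

regions : ∀ A B C → ¬ (T (has A) × T (has B) × T (has C)) →
  (fromBool (has A) ≡ sum (map fromBool (has A ∧ has B ∷ has A ∧ has C ∷ only₁ A B C ∷ []))) ×
  (fromBool (has B) ≡ sum (map fromBool (has A ∧ has B ∷ has B ∧ has C ∷ only₂ A B C ∷ []))) ×
  (fromBool (has C) ≡ sum (map fromBool (has B ∧ has C ∷ has A ∧ has C ∷ only₃ A B C ∷ []))) ×
  (1 ≡ sum (map fromBool (has A ∧ has B ∷ has B ∧ has C ∷ has A ∧ has C ∷
                          only₁ A B C ∷ only₂ A B C ∷ only₃ A B C ∷ none A B C ∷ [])))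
regions (just a) (just b) (just c) not-all = ⊥-elim (not-all (tt , tt , tt))
regions (just a) (just b) nothing  _       = refl , refl , refl , refl
regions (just a) nothing  (just c) _       = refl , refl , refl , refl
regions (just a) nothing  nothing  _       = refl , refl , refl , refl
regions nothing  (just b) (just c) _       = refl , refl , refl , refl
regions nothing  (just b) nothing  _       = refl , refl , refl , refl
regions nothing  nothing  (just c) _       = refl , refl , refl , refl
regions nothing  nothing  nothing  _       = refl , refl , refl , refl

-- The colour of the new vertex at a colour that x₁, x₂, x₃ carry as A, B, C, where eᵢ is the
-- sign of the new edge to xᵢ: a colour private to xᵢ is taken when the flag tᵢ is set.
module Apex (e₁ e₂ e₃ : Sign) where

  apexColour : Bool → Bool → Bool → Maybe Sign → Maybe Sign → Maybe Sign → Maybe Sign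
  apexColour t₁ t₂ t₃ (just a) nothing  nothing  = if t₁ then just (e₁ · a) else nothing
  apexColour t₁ t₂ t₃ nothing  (just b) nothing  = if t₂ then just (e₂ · b) else nothing
  apexColour t₁ t₂ t₃ nothing  nothing  (just c) = if t₃ then just (e₃ · c) else nothing
  apexColour t₁ t₂ t₃ nothing  nothing  nothing  = just pos
  apexColour t₁ t₂ t₃ _        _        _        = nothing

  apex-consistent : ∀ t₁ t₂ t₃ A B C → let D = apexColour t₁ t₂ t₃ A B C in
                    Consistent e₁ D A × Consistent e₂ D B × Consistent e₃ D C
  apex-consistent true  t₂    t₃    (just a) nothing  nothing  = ·-cancelʳ e₁ a , tt , tt
  apex-consistent false t₂    t₃    (just a) nothing  nothing  = tt , tt , tt
  apex-consistent t₁    true  t₃    nothing  (just b) nothing  = tt , ·-cancelʳ e₂ b , tt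
  apex-consistent t₁    false t₃    nothing  (just b) nothing  = tt , tt , tt
  apex-consistent t₁    t₂    true  nothing  nothing  (just c) = tt , tt , ·-cancelʳ e₃ c
  apex-consistent t₁    t₂    false nothing  nothing  (just c) = tt , tt , tt
  apex-consistent t₁    t₂    t₃    nothing  nothing  nothing  = tt , tt , tt
  apex-consistent t₁    t₂    t₃    (just a) (just b) C        = tt , tt , tt
  apex-consistent t₁    t₂    t₃    (just a) nothing  (just c) = tt , tt , tt
  apex-consistent t₁    t₂    t₃    nothing  (just b) (just c) = tt , tt , tt

  apex-counts : ∀ t₁ t₂ t₃ A B C → let D = apexColour t₁ t₂ t₃ A B C in
    (fromBool (has D) ≡ sum (map fromBool (none A B C ∷ only₁ A B C ∧ t₁ ∷
                                           only₂ A B C ∧ t₂ ∷ only₃ A B C ∧ t₃ ∷ []))) ×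
    (has D ∧ has A ≡ only₁ A B C ∧ t₁) × (has D ∧ has B ≡ only₂ A B C ∧ t₂) ×
    (has D ∧ has C ≡ only₃ A B C ∧ t₃)
  apex-counts true  t₂    t₃    (just a) nothing  nothing  = refl , refl , refl , refl
  apex-counts false t₂    t₃    (just a) nothing  nothing  = refl , refl , refl , refl
  apex-counts t₁    true  t₃    nothing  (just b) nothing  = refl , refl , refl , refl
  apex-counts t₁    false t₃    nothing  (just b) nothing  = refl , refl , refl , refl
  apex-counts t₁    t₂    true  nothing  nothing  (just c) = refl , refl , refl , refl
  apex-counts t₁    t₂    false nothing  nothing  (just c) = refl , refl , refl , refl
  apex-counts t₁    t₂    t₃    nothing  nothing  nothing  = refl , refl , refl , refl
  apex-counts t₁    t₂    t₃    (just a) (just b) C        = refl , refl , refl , refl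
  apex-counts t₁    t₂    t₃    (just a) nothing  (just c) = refl , refl , refl , refl
  apex-counts t₁    t₂    t₃    nothing  (just b) (just c) = refl , refl , refl , refl

-- ωᵢ colours private to xᵢ and f free colours; the new vertex takes min(14, ω₁) and
-- min(14, ω₂) private colours of x₁ and x₂, all free ones, and fills up from those of x₃.
ApexSizes : ℕ → ℕ → ℕ → ℕ → Set
ApexSizes ω₁ ω₂ ω₃ f = f + (n₁ + (n₂ + (n₃ + 0))) ≡ 41 × Overlap n₁ × Overlap n₂ × Overlap n₃
  where
  n₁ = 14 ⊓ ω₁
  n₂ = 14 ⊓ ω₂
  n₃ = (41 ∸ (f + (n₁ + n₂))) ⊓ ω₃

-- Matching on the overlaps determines ω₁, ω₂, ω₃ and f by unification; in the cases marked ()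
-- the colour sets of x₁, x₂, x₃ would need more than 83 colours.
apex-table : ∀ {A₁₂ A₂₃ A₁₃ ω₁ ω₂ ω₃ f} → Overlap A₁₂ → Overlap A₂₃ → Overlap A₁₃ →
  A₁₂ + (A₁₃ + ω₁) ≡ 41 → A₁₂ + (A₂₃ + ω₂) ≡ 41 → A₂₃ + (A₁₃ + ω₃) ≡ 41 →
  A₁₂ + (A₂₃ + (A₁₃ + (ω₁ + (ω₂ + (ω₃ + f))))) ≡ 83 → ApexSizes ω₁ ω₂ ω₃ f
apex-table twelve   twelve   twelve   refl refl refl ()
apex-table twelve   twelve   thirteen refl refl refl ()
apex-table twelve   twelve   fourteen refl refl refl ()
apex-table twelve   thirteen twelve   refl refl refl ()
apex-table twelve   thirteen thirteen refl refl refl ()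
apex-table twelve   thirteen fourteen refl refl refl ()
apex-table twelve   fourteen twelve   refl refl refl ()
apex-table twelve   fourteen thirteen refl refl refl ()
apex-table twelve   fourteen fourteen refl refl refl refl = refl , fourteen , fourteen , thirteen
apex-table thirteen twelve   twelve   refl refl refl ()
apex-table thirteen twelve   thirteen refl refl refl ()
apex-table thirteen twelve   fourteen refl refl refl ()
apex-table thirteen thirteen twelve   refl refl refl ()
apex-table thirteen thirteen thirteen refl refl refl ()
apex-table thirteen thirteen fourteen refl refl refl refl = refl , fourteen , fourteen , thirteen
apex-table thirteen fourteen twelve   refl refl refl ()
apex-table thirteen fourteen thirteen refl refl refl refl = refl , fourteen , fourteen , thirteen
apex-table thirteen fourteen fourteen refl refl refl refl = refl , fourteen , fourteen , twelve
apex-table fourteen twelve   twelve   refl refl refl ()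
apex-table fourteen twelve   thirteen refl refl refl ()
apex-table fourteen twelve   fourteen refl refl refl refl = refl , thirteen , fourteen , fourteen
apex-table fourteen thirteen twelve   refl refl refl ()
apex-table fourteen thirteen thirteen refl refl refl refl = refl , fourteen , fourteen , thirteen
apex-table fourteen thirteen fourteen refl refl refl refl = refl , thirteen , fourteen , thirteen
apex-table fourteen fourteen twelve   refl refl refl refl = refl , fourteen , thirteen , fourteen
apex-table fourteen fourteen thirteen refl refl refl refl = refl , fourteen , thirteen , thirteen
apex-table fourteen fourteen fourteen refl refl refl refl = refl , thirteen , thirteen , thirteen

-- apex-table for hypotheses in the shape count-∑ produces, where every sum ends in + 0.
apex-arithmetic : ∀ {A₁₂ A₂₃ A₁₃ ω₁ ω₂ ω₃ f} → Overlap A₁₂ → Overlap A₂₃ → Overlap A₁₃ →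
  A₁₂ + (A₁₃ + (ω₁ + 0)) ≡ 41 → A₁₂ + (A₂₃ + (ω₂ + 0)) ≡ 41 → A₂₃ + (A₁₃ + (ω₃ + 0)) ≡ 41 →
  A₁₂ + (A₂₃ + (A₁₃ + (ω₁ + (ω₂ + (ω₃ + (f + 0)))))) ≡ 83 → ApexSizes ω₁ ω₂ ω₃ f
apex-arithmetic {ω₁ = ω₁} {ω₂} {ω₃} {f}
  rewrite +-identityʳ ω₁ | +-identityʳ ω₂ | +-identityʳ ω₃ | +-identityʳ f = apex-table

module NewVertex {n} {G : SG n} (𝒞 : SignedColouring G) {x₁ x₂ x₃ : Fin n} (s₁ s₂ s₃ sₙ : Sign)
  (negative : NegCycle G (x₁ ∷ x₂ ∷ x₃ ∷ []))
  (x₁x₂ : SEdge G x₁ x₂ (s₁ · neg · s₂)) (x₂x₃ : SEdge G x₂ x₃ (s₂ · neg · s₃))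
  (x₁x₃ : SEdge G x₁ x₃ (s₁ · neg · s₃)) where

  open SignedColouring 𝒞
  open Apex (sₙ · neg · s₁) (sₙ · neg · s₂) (sₙ · neg · s₃)

  X₁ X₂ X₃ : SignedSet 83
  X₁ = colour x₁
  X₂ = colour x₂
  X₃ = colour x₃

  region : (Maybe Sign → Maybe Sign → Maybe Sign → Bool) → Fin 83 → Bool
  region R k = R (X₁ k) (X₂ k) (X₃ k)

  ω₁ ω₂ ω₃ f : ℕ
  ω₁ = count (region only₁)
  ω₂ = count (region only₂)
  ω₃ = count (region only₃)
  f  = count (region none)

  no-colour-on-all : ∀ k → ¬ (T (has (X₁ k)) × T (has (X₂ k)) × T (has (X₃ k)))
  no-colour-on-all k (h₁ , h₂ , h₃) = colourClass-balanced 𝒞 k _ negative (h₁ ∷ h₂ ∷ h₃ ∷ [])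

  X₁-split : card X₁ ≡ common X₁ X₂ + (common X₁ X₃ + (ω₁ + 0))
  X₁-split = count-∑ (has ∘ X₁)
    ((λ k → has (X₁ k) ∧ has (X₂ k)) ∷ (λ k → has (X₁ k) ∧ has (X₃ k)) ∷ region only₁ ∷ [])
    (λ k → proj₁ (regions (X₁ k) (X₂ k) (X₃ k) (no-colour-on-all k)))

  X₂-split : card X₂ ≡ common X₁ X₂ + (common X₂ X₃ + (ω₂ + 0))
  X₂-split = count-∑ (has ∘ X₂)
    ((λ k → has (X₁ k) ∧ has (X₂ k)) ∷ (λ k → has (X₂ k) ∧ has (X₃ k)) ∷ region only₂ ∷ [])
    (λ k → proj₁ (proj₂ (regions (X₁ k) (X₂ k) (X₃ k) (no-colour-on-all k))))

  X₃-split : card X₃ ≡ common X₂ X₃ + (common X₁ X₃ + (ω₃ + 0))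
  X₃-split = count-∑ (has ∘ X₃)
    ((λ k → has (X₂ k) ∧ has (X₃ k)) ∷ (λ k → has (X₁ k) ∧ has (X₃ k)) ∷ region only₃ ∷ [])
    (λ k → proj₁ (proj₂ (proj₂ (regions (X₁ k) (X₂ k) (X₃ k) (no-colour-on-all k)))))

  all-split : 83 ≡ common X₁ X₂ + (common X₂ X₃ + (common X₁ X₃ + (ω₁ + (ω₂ + (ω₃ + (f + 0))))))
  all-split = count-∑ (λ _ → true)
    ((λ k → has (X₁ k) ∧ has (X₂ k)) ∷ (λ k → has (X₂ k) ∧ has (X₃ k)) ∷
     (λ k → has (X₁ k) ∧ has (X₃ k)) ∷
     region only₁ ∷ region only₂ ∷ region only₃ ∷ region none ∷ [])
    (λ k → proj₂ (proj₂ (proj₂ (regions (X₁ k) (X₂ k) (X₃ k) (no-colour-on-all k)))))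

  sizes : ApexSizes ω₁ ω₂ ω₃ f
  sizes = apex-arithmetic
    (proj₂ (fits-SEdge 𝒞 x₁x₂)) (proj₂ (fits-SEdge 𝒞 x₂x₃)) (proj₂ (fits-SEdge 𝒞 x₁x₃))
    (trans (sym X₁-split) (card≡41 x₁)) (trans (sym X₂-split) (card≡41 x₂))
    (trans (sym X₃-split) (card≡41 x₃)) (sym all-split)

  take₁ take₂ take₃ taken₁ taken₂ taken₃ : Fin 83 → Bool
  take₁ = takeFirst 14 (region only₁)
  take₂ = takeFirst 14 (region only₂)
  take₃ = takeFirst (41 ∸ (f + (14 ⊓ ω₁ + 14 ⊓ ω₂))) (region only₃)
  taken₁ k = region only₁ k ∧ take₁ k
  taken₂ k = region only₂ k ∧ take₂ k
  taken₃ k = region only₃ k ∧ take₃ k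

  apex : SignedSet 83
  apex k = apexColour (take₁ k) (take₂ k) (take₃ k) (X₁ k) (X₂ k) (X₃ k)

  consistent-at : ∀ k → Consistent (sₙ · neg · s₁) (apex k) (X₁ k) ×
                        Consistent (sₙ · neg · s₂) (apex k) (X₂ k) ×
                        Consistent (sₙ · neg · s₃) (apex k) (X₃ k)
  consistent-at k = apex-consistent (take₁ k) (take₂ k) (take₃ k) (X₁ k) (X₂ k) (X₃ k)

  counts-at : ∀ k →
    (fromBool (has (apex k)) ≡
       sum (map (λ R → fromBool (R k)) (region none ∷ taken₁ ∷ taken₂ ∷ taken₃ ∷ []))) ×
    (has (apex k) ∧ has (X₁ k) ≡ taken₁ k) × (has (apex k) ∧ has (X₂ k) ≡ taken₂ k) ×
    (has (apex k) ∧ has (X₃ k) ≡ taken₃ k)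
  counts-at k = apex-counts (take₁ k) (take₂ k) (take₃ k) (X₁ k) (X₂ k) (X₃ k)

  count-taken₁ : count taken₁ ≡ 14 ⊓ ω₁
  count-taken₁ = count-takeFirst 14 (region only₁)

  count-taken₂ : count taken₂ ≡ 14 ⊓ ω₂
  count-taken₂ = count-takeFirst 14 (region only₂)

  count-taken₃ : count taken₃ ≡ (41 ∸ (f + (14 ⊓ ω₁ + 14 ⊓ ω₂))) ⊓ ω₃
  count-taken₃ = count-takeFirst (41 ∸ (f + (14 ⊓ ω₁ + 14 ⊓ ω₂))) (region only₃)

  card-apex : card apex ≡ 41
  card-apex = begin
    card apex
      ≡⟨ count-∑ (has ∘ apex) (region none ∷ taken₁ ∷ taken₂ ∷ taken₃ ∷ [])
                 (λ k → proj₁ (counts-at k)) ⟩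
    f + (count taken₁ + (count taken₂ + (count taken₃ + 0)))
      ≡⟨ cong₂ (λ m r → f + (m + r)) count-taken₁
               (cong₂ (λ m r → m + (r + 0)) count-taken₂ count-taken₃) ⟩
    f + (14 ⊓ ω₁ + (14 ⊓ ω₂ + ((41 ∸ (f + (14 ⊓ ω₁ + 14 ⊓ ω₂))) ⊓ ω₃ + 0)))
      ≡⟨ proj₁ sizes ⟩
    41 ∎

  fits₁ : Fits (sₙ · neg · s₁) apex X₁
  fits₁ = (λ k → proj₁ (consistent-at k)) ,
    subst Overlap (sym (trans (count-cong λ k → proj₁ (proj₂ (counts-at k))) count-taken₁))
      (proj₁ (proj₂ sizes))

  fits₂ : Fits (sₙ · neg · s₂) apex X₂
  fits₂ = (λ k → proj₁ (proj₂ (consistent-at k))) ,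
    subst Overlap (sym (trans (count-cong λ k → proj₁ (proj₂ (proj₂ (counts-at k)))) count-taken₂))
      (proj₁ (proj₂ (proj₂ sizes)))

  fits₃ : Fits (sₙ · neg · s₃) apex X₃
  fits₃ = (λ k → proj₂ (proj₂ (consistent-at k))) ,
    subst Overlap (sym (trans (count-cong λ k → proj₂ (proj₂ (proj₂ (counts-at k)))) count-taken₃))
      (proj₂ (proj₂ (proj₂ sizes)))

  colour′ : Fin (suc n) → SignedSet 83
  colour′ = snoc n colour apex

  card′ : ∀ i → card (colour′ i) ≡ 41
  card′ = snoc-all (λ A → card A ≡ 41) n colour apex card≡41 card-apex

  fits-apex : ∀ {σ j} → Fits σ apex (colour j) → Fits σ (colour′ (fromℕ n)) (colour′ (inject₁ j))
  fits-apex {σ} {j} =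
    subst₂ (Fits σ) (sym (snoc-fromℕ n colour apex)) (sym (snoc-inject₁ n colour apex j))

  fits-old : ∀ {e} → FitsEdge colour e →
             FitsEdge colour′ (inject₁ (proj₁ e) , inject₁ (proj₁ (proj₂ e)) , proj₂ (proj₂ e))
  fits-old = relabel {c = colour} {c′ = colour′} inject₁ (snoc-inject₁ n colour apex)

data Class : Set where
  both onlyP onlyQ neither : Class

classOf : Bool → Bool → Class
classOf true  true  = both
classOf true  false = onlyP
classOf false true  = onlyQ
classOf false false = neither

inClass : Class → Bool → Bool → Bool
inClass both    p q = p ∧ q
inClass onlyP   p q = p ∧ not q
inClass onlyQ   p q = not p ∧ q
inClass neither p q = not p ∧ not q

inClass-classOf : ∀ p q → T (inClass (classOf p q) p q)
inClass-classOf true  true  = tt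
inClass-classOf true  false = tt
inClass-classOf false true  = tt
inClass-classOf false false = tt

classes : List Class
classes = neither ∷ both ∷ onlyP ∷ onlyQ ∷ []

class-split : ∀ p q (g : Class → Bool) →
              fromBool (g (classOf p q)) ≡ sum (map (λ c → fromBool (inClass c p q ∧ g c)) classes)
class-split true  true  g = sym (+-identityʳ _)
class-split true  false g = sym (+-identityʳ _)
class-split false true  g = sym (+-identityʳ _)
class-split false false g = sym (+-identityʳ _)

class-partition : ∀ p q →
  (fromBool p ≡ sum (map fromBool (p ∧ q ∷ p ∧ not q ∷ []))) ×
  (fromBool q ≡ sum (map fromBool (p ∧ q ∷ not p ∧ q ∷ []))) ×
  (1 ≡ sum (map fromBool (not p ∧ not q ∷ p ∧ q ∷ p ∧ not q ∷ not p ∧ q ∷ [])))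
class-partition true  true  = refl , refl , refl
class-partition true  false = refl , refl , refl
class-partition false true  = refl , refl , refl
class-partition false false = refl , refl , refl

second-summand : ∀ m n o → m + (n + 0) ≡ o → n ≡ o ∸ m
second-summand m n o m+n≡o = begin
  n               ≡⟨ sym (+-identityʳ n) ⟩
  n + 0           ≡⟨ sym (m+n∸m≡n m (n + 0)) ⟩
  m + (n + 0) ∸ m ≡⟨ cong (_∸ m) m+n≡o ⟩
  o ∸ m           ∎

classSize : ℕ → Class → ℕ
classSize i both    = i
classSize i onlyP   = 41 ∸ i
classSize i onlyQ   = 41 ∸ i
classSize i neither = 83 ∸ (i + 2 * (41 ∸ i))

-- One colour class of a coloured copy of Ŵ'.
Pattern : Set
Pattern = WV → Maybe Sign

⊕ ⊖ ○ : Maybe Sign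
⊕ = just pos
⊖ = just neg
○ = nothing

mk : (cu cv cw cz ct c₁ c₂ c₃ c₄ c₅ ca₁ ca₂ ca₃ cb₁ cb₂ cb₃ : Maybe Sign) → Pattern
mk cu cv cw cz ct c₁ c₂ c₃ c₄ c₅ ca₁ ca₂ ca₃ cb₁ cb₂ cb₃ = λ where
  u  → cu
  v  → cv
  w  → cw
  z  → cz
  t  → ct
  x1 → c₁
  x2 → c₂
  x3 → c₃
  x4 → c₄
  x5 → c₅
  a1 → ca₁
  a2 → ca₂
  a3 → ca₃
  b1 → cb₁
  b2 → cb₂
  b3 → cb₃

-- Patterns are switched so that u gets sign +, and v gets − when u is present (uv is negative).
endU endV : Class → Maybe Sign
endU both    = ⊕
endU onlyP   = ⊕
endU onlyQ   = ○
endU neither = ○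
endV both    = ⊖
endV onlyP   = ○
endV onlyQ   = ⊕
endV neither = ○

ConsistentOn : Pattern → WV × WV × Sign → Set
ConsistentOn π (a , b , s) = Consistent s (π a) (π b)

ValidPattern : Class → Pattern → Set
ValidPattern c π = π u ≡ endU c × π v ≡ endV c × All (ConsistentOn π) W'edges

validPattern? : ∀ c π → Dec (ValidPattern c π)
validPattern? c π =
  ≡-dec _≟ˢ_ (π u) (endU c) ×-dec ≡-dec _≟ˢ_ (π v) (endV c) ×-dec
  All.all? (λ e → consistent? (proj₂ (proj₂ e)) (π (proj₁ e)) (π (proj₁ (proj₂ e)))) W'edges

Template : Set
Template = Class → List Pattern

expand : List (ℕ × Pattern) → List Pattern
expand = concatMap (uncurry replicate)

tally : Template → (Pattern → Bool) → ℕ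
tally T F = sum (map (λ c → countᴸ F (T c)) classes)

presentAt : WV → Pattern → Bool
presentAt y π = has (π y)

bothPresent : WV × WV × Sign → Pattern → Bool
bothPresent (a , b , _) π = has (π a) ∧ has (π b)

-- vertexAt (newIx y) reduces to y for each of the 14 vertices other than u and v.
vertexAt : Fin 14 → WV
vertexAt = lookup (w ∷ z ∷ t ∷ x1 ∷ x2 ∷ x3 ∷ x4 ∷ x5 ∷ a1 ∷ a2 ∷ a3 ∷ b1 ∷ b2 ∷ b3 ∷ [])

record ValidTemplate (i : ℕ) (T : Template) : Set where
  field
    lengths  : ∀ c → length (T c) ≡ classSize i c
    patterns : ∀ c → True (All.all? (validPattern? c) (T c))
    sizes    : True (allFin? (λ m → tally T (presentAt (vertexAt m)) ≟ 41))
    overlaps : True (All.all? (λ e → overlap? (tally T (bothPresent e))) W'edges)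

module Gadget {n} {G : SG n} (𝒞 : SignedColouring G) (p q : Fin n) (sw : WV → Sign) {σ : Sign}
  (fits-pq : Fits σ (SignedColouring.colour 𝒞 p) (SignedColouring.colour 𝒞 q))
  (switch-uv : sw u · σuv · sw v ≡ σ) (T : Template)
  (valid : ValidTemplate (common (SignedColouring.colour 𝒞 p) (SignedColouring.colour 𝒞 q)) T) where

  open SignedColouring 𝒞
  open ValidTemplate valid

  i : ℕ
  i = common (colour p) (colour q)

  P Q : Fin 83 → Bool
  P k = has (colour p k)
  Q k = has (colour q k)

  member : Class → Fin 83 → Bool
  member c k = inClass c (P k) (Q k)

  count-onlyP : count (member onlyP) ≡ 41 ∸ i
  count-onlyP = second-summand i _ 41 (trans (sym P-split) (card≡41 p))
    where
    P-split : card (colour p) ≡ i + (count (member onlyP) + 0)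
    P-split = count-∑ P (member both ∷ member onlyP ∷ [])
                (λ k → proj₁ (class-partition (P k) (Q k)))

  count-onlyQ : count (member onlyQ) ≡ 41 ∸ i
  count-onlyQ = second-summand i _ 41 (trans (sym Q-split) (card≡41 q))
    where
    Q-split : card (colour q) ≡ i + (count (member onlyQ) + 0)
    Q-split = count-∑ Q (member both ∷ member onlyQ ∷ [])
                (λ k → proj₁ (proj₂ (class-partition (P k) (Q k))))

  count-neither : count (member neither) ≡
                  83 ∸ (i + (count (member onlyP) + (count (member onlyQ) + 0)))
  count-neither =
    trans (sym (m+n∸n≡m (count (member neither)) rest)) (cong (_∸ rest) (sym all-split))
    where
    rest : ℕ
    rest = i + (count (member onlyP) + (count (member onlyQ) + 0))
    all-split : 83 ≡ count (member neither) + rest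
    all-split = count-∑ (λ _ → true)
                  (member neither ∷ member both ∷ member onlyP ∷ member onlyQ ∷ [])
                  (λ k → proj₂ (proj₂ (class-partition (P k) (Q k))))

  length≡count : ∀ c → length (T c) ≡ count (member c)
  length≡count both    = lengths both
  length≡count onlyP   = trans (lengths onlyP) (sym count-onlyP)
  length≡count onlyQ   = trans (lengths onlyQ) (sym count-onlyQ)
  length≡count neither = trans (lengths neither) (sym (trans count-neither
    (cong₂ (λ a b → 83 ∸ (i + (a + (b + 0)))) count-onlyP count-onlyQ)))

  assign : Class → Fin 83 → Pattern
  assign c = allocate (member c) (λ _ → ○) (T c)

  patternAt : Fin 83 → Pattern
  patternAt k = assign (classOf (P k) (Q k)) k

  patternAt-valid : ∀ k → ValidPattern (classOf (P k) (Q k)) (patternAt k)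
  patternAt-valid k = All.lookup (toWitness (patterns c))
    (allocate-∈ (member c) (λ _ → ○) (T c) (length≡count c) (inClass-classOf (P k) (Q k)))
    where c = classOf (P k) (Q k)

  count≡tally : ∀ F → count (F ∘ patternAt) ≡ tally T F
  count≡tally F = trans
    (count-∑ (F ∘ patternAt) (map (λ c k → member c k ∧ F (assign c k)) classes)
      (λ k → class-split (P k) (Q k) (λ c → F (assign c k))))
    (cong sum (map-cong (λ c → count-allocate (member c) (λ _ → ○) (T c) F (length≡count c))
                        classes))

  -- The pattern of a colour is switched to agree with p and q at u and v.
  reference : Maybe Sign → Maybe Sign → Sign
  reference (just a) _        = sw u · a
  reference nothing  (just b) = sw v · b
  reference nothing  nothing  = pos

  act : WV → SignedSet 83
  act y k = switch (sw y) (switch (reference (colour p k) (colour q k)) (patternAt k y))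

  restores-u : ∀ A B (π : Pattern) → π u ≡ endU (classOf (has A) (has B)) →
               switch (sw u) (switch (reference A B) (π u)) ≡ A
  restores-u (just a) (just b) π πu rewrite πu = cong just (switch-back (sw u) a)
  restores-u (just a) nothing  π πu rewrite πu = cong just (switch-back (sw u) a)
  restores-u nothing  (just b) π πu rewrite πu = refl
  restores-u nothing  nothing  π πu rewrite πu = refl

  restores-v : ∀ A B (π : Pattern) → Consistent σ A B → π v ≡ endV (classOf (has A) (has B)) →
               switch (sw v) (switch (reference A B) (π v)) ≡ B
  restores-v (just a) (just b) π ab≡σ πv rewrite πv = cong just (begin
    sw v · (sw u · a · neg)   ≡⟨ ·-shuffle (sw u) (sw v) a ⟩
    a · (sw u · neg · sw v)   ≡⟨ cong (a ·_) (trans switch-uv (sym ab≡σ)) ⟩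
    a · (a · b)               ≡⟨ ·-cancelˡ a b ⟩
    b                         ∎)
  restores-v (just a) nothing  π _ πv rewrite πv = refl
  restores-v nothing  (just b) π _ πv rewrite πv = cong just (switch-back (sw v) b)
  restores-v nothing  nothing  π _ πv rewrite πv = refl

  act-u : ∀ k → act u k ≡ colour p k
  act-u k = restores-u (colour p k) (colour q k) (patternAt k) (proj₁ (patternAt-valid k))

  act-v : ∀ k → act v k ≡ colour q k
  act-v k = restores-v (colour p k) (colour q k) (patternAt k) (proj₁ fits-pq k)
              (proj₁ (proj₂ (patternAt-valid k)))

  has-act : ∀ y k → has (act y k) ≡ has (patternAt k y)
  has-act y k = trans (has-switch (sw y) _) (has-switch _ (patternAt k y))

  act-fits : ∀ {e} → e ∈ W'edges →
             Fits (sw (proj₁ e) · proj₂ (proj₂ e) · sw (proj₁ (proj₂ e)))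
                  (act (proj₁ e)) (act (proj₁ (proj₂ e)))
  act-fits {a , b , s} e∈ =
    consistent , subst Overlap (sym shared) (All.lookup (toWitness overlaps) e∈)
    where
    consistent : ∀ k → Consistent (sw a · s · sw b) (act a k) (act b k)
    consistent k = Consistent-switch (sw a) (sw b) _ _
      (subst (λ s′ → Consistent s′ (switch r (patternAt k a)) (switch r (patternAt k b)))
             (·-conjugate r s)
        (Consistent-switch r r (patternAt k a) (patternAt k b)
          (All.lookup (proj₂ (proj₂ (patternAt-valid k))) e∈)))
      where r = reference (colour p k) (colour q k)
    shared : common (act a) (act b) ≡ tally T (bothPresent (a , b , s))
    shared = trans (count-cong (λ k → cong₂ _∧_ (has-act a k) (has-act b k)))
                   (count≡tally (bothPresent (a , b , s)))

  colour′ : Fin (n + 14) → SignedSet 83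
  colour′ j = [ colour , act ∘ vertexAt ]′ (splitAt n j)

  colour′-old : ∀ j → colour′ (j ↑ˡ 14) ≡ colour j
  colour′-old j = cong [ colour , act ∘ vertexAt ]′ (splitAt-↑ˡ n j 14)

  colour′-new : ∀ m → colour′ (n ↑ʳ m) ≡ act (vertexAt m)
  colour′-new m = cong [ colour , act ∘ vertexAt ]′ (splitAt-↑ʳ n 14 m)

  colour′-embed : ∀ y → colour′ (embed p q y) ≗ act y
  colour′-embed u k = trans (cong-app (colour′-old p) k) (sym (act-u k))
  colour′-embed v k = trans (cong-app (colour′-old q) k) (sym (act-v k))
  colour′-embed w   = cong-app (colour′-new (newIx w))
  colour′-embed z   = cong-app (colour′-new (newIx z))
  colour′-embed t   = cong-app (colour′-new (newIx t))
  colour′-embed x1  = cong-app (colour′-new (newIx x1))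
  colour′-embed x2  = cong-app (colour′-new (newIx x2))
  colour′-embed x3  = cong-app (colour′-new (newIx x3))
  colour′-embed x4  = cong-app (colour′-new (newIx x4))
  colour′-embed x5  = cong-app (colour′-new (newIx x5))
  colour′-embed a1  = cong-app (colour′-new (newIx a1))
  colour′-embed a2  = cong-app (colour′-new (newIx a2))
  colour′-embed a3  = cong-app (colour′-new (newIx a3))
  colour′-embed b1  = cong-app (colour′-new (newIx b1))
  colour′-embed b2  = cong-app (colour′-new (newIx b2))
  colour′-embed b3  = cong-app (colour′-new (newIx b3))

  card′ : ∀ j → card (colour′ j) ≡ 41
  card′ j = card-split (splitAt n j)
    where
    card-split : ∀ s → card ([ colour , act ∘ vertexAt ]′ s) ≡ 41
    card-split (inj₁ j) = card≡41 j
    card-split (inj₂ m) = begin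
      card (act (vertexAt m))                    ≡⟨ count-cong (has-act (vertexAt m)) ⟩
      count (presentAt (vertexAt m) ∘ patternAt) ≡⟨ count≡tally (presentAt (vertexAt m)) ⟩
      tally T (presentAt (vertexAt m))           ≡⟨ toWitness sizes m ⟩
      41                                         ∎

  fits-copy : ∀ {e} → e ∈ W'edges →
              FitsEdge colour′ (embed p q (proj₁ e) , embed p q (proj₁ (proj₂ e)) ,
                                sw (proj₁ e) · proj₂ (proj₂ e) · sw (proj₁ (proj₂ e)))
  fits-copy {a , b , s} e∈ = Fits-cong (sym ∘ colour′-embed a) (sym ∘ colour′-embed b) (act-fits e∈)

  fits-old : ∀ {e} → FitsEdge colour e →
             FitsEdge colour′ (proj₁ e ↑ˡ 14 , proj₁ (proj₂ e) ↑ˡ 14 , proj₂ (proj₂ e))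
  fits-old = relabel {c = colour} {c′ = colour′} (_↑ˡ 14) colour′-old

-- Patterns with multiplicities, class by class; valid₁₂, valid₁₃, valid₁₄ check them by evaluation.
template₁₂ : Template
template₁₂ both = expand
  ( (1 , mk ⊕ ⊖ ⊖ ○ ○ ○ ○ ⊕ ○ ○ ○ ⊖ ⊕ ⊖ ⊕ ○)
  ∷ (1 , mk ⊕ ⊖ ⊖ ○ ○ ○ ⊕ ○ ○ ○ ⊖ ○ ○ ○ ⊕ ⊖)
  ∷ (2 , mk ⊕ ⊖ ○ ○ ○ ⊖ ○ ⊕ ⊖ ○ ⊕ ⊖ ○ ○ ○ ○)
  ∷ (2 , mk ⊕ ⊖ ○ ○ ○ ○ ○ ⊕ ○ ⊖ ⊖ ○ ⊕ ⊖ ⊕ ○)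
  ∷ (2 , mk ⊕ ⊖ ○ ○ ○ ○ ⊕ ○ ⊖ ○ ⊖ ○ ○ ⊕ ○ ○)
  ∷ (2 , mk ⊕ ⊖ ○ ○ ○ ○ ⊕ ○ ○ ⊖ ⊖ ○ ○ ⊕ ○ ⊖)
  ∷ (2 , mk ⊕ ⊖ ⊕ ○ ○ ○ ○ ○ ○ ⊖ ⊖ ○ ⊕ ⊕ ○ ⊖)
  ∷ [])
template₁₂ onlyP = expand
  ( (7 , mk ⊕ ○ ⊖ ⊖ ⊖ ○ ○ ⊕ ○ ○ ⊖ ○ ⊕ ○ ⊖ ⊕)
  ∷ (1 , mk ⊕ ○ ⊖ ⊖ ⊖ ○ ⊕ ○ ⊕ ○ ⊖ ○ ○ ○ ○ ⊕)
  ∷ (5 , mk ⊕ ○ ○ ⊖ ○ ⊖ ○ ⊕ ⊖ ○ ⊕ ⊖ ○ ○ ⊖ ○)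
  ∷ (1 , mk ⊕ ○ ○ ⊖ ○ ○ ⊕ ○ ⊕ ⊖ ⊖ ○ ○ ⊖ ⊕ ○)
  ∷ (2 , mk ⊕ ○ ○ ○ ⊖ ⊖ ○ ⊖ ⊕ ○ ⊕ ⊖ ○ ○ ⊕ ○)
  ∷ (2 , mk ⊕ ○ ○ ○ ○ ⊖ ⊕ ⊖ ⊕ ○ ○ ○ ○ ○ ⊕ ○)
  ∷ (3 , mk ⊕ ○ ○ ○ ○ ○ ⊕ ⊖ ⊕ ⊖ ⊖ ○ ○ ○ ⊕ ○)
  ∷ (1 , mk ⊕ ○ ○ ○ ○ ○ ⊕ ○ ⊕ ⊖ ⊖ ○ ○ ⊖ ⊕ ○)
  ∷ (1 , mk ⊕ ○ ○ ○ ○ ○ ⊕ ○ ⊕ ⊖ ⊖ ○ ○ ○ ○ ⊕)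
  ∷ (3 , mk ⊕ ○ ⊕ ○ ⊖ ⊖ ○ ⊖ ○ ○ ⊕ ⊖ ○ ○ ⊕ ⊖)
  ∷ (1 , mk ⊕ ○ ⊕ ○ ⊖ ○ ○ ⊖ ○ ○ ⊖ ○ ⊕ ○ ⊕ ⊖)
  ∷ (1 , mk ⊕ ○ ⊕ ○ ○ ○ ○ ⊖ ○ ⊖ ⊖ ○ ⊕ ○ ⊕ ⊖)
  ∷ (1 , mk ⊕ ○ ⊕ ○ ○ ○ ○ ⊖ ○ ⊖ ○ ⊖ ○ ○ ⊕ ⊖)
  ∷ [])
template₁₂ onlyQ = expand
  ( (9 , mk ○ ⊕ ⊖ ⊖ ⊖ ○ ⊕ ○ ○ ⊕ ○ ○ ⊕ ⊖ ○ ⊕)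
  ∷ (1 , mk ○ ⊕ ⊖ ⊖ ⊖ ○ ⊕ ○ ○ ⊕ ○ ○ ⊕ ○ ⊖ ○)
  ∷ (2 , mk ○ ⊕ ⊖ ⊖ ○ ○ ⊕ ○ ⊕ ○ ○ ○ ⊕ ⊖ ○ ○)
  ∷ (1 , mk ○ ⊕ ○ ⊖ ○ ⊕ ○ ○ ⊕ ⊖ ⊖ ○ ○ ⊖ ○ ○)
  ∷ (1 , mk ○ ⊕ ○ ⊖ ○ ⊕ ○ ○ ⊕ ⊖ ⊖ ○ ⊕ ⊖ ○ ○)
  ∷ (2 , mk ○ ⊕ ○ ○ ⊖ ⊖ ⊕ ⊖ ○ ○ ○ ⊕ ○ ⊕ ⊖ ○)
  ∷ (2 , mk ○ ⊕ ○ ○ ⊖ ⊖ ⊕ ⊖ ○ ⊕ ○ ⊕ ○ ⊕ ⊖ ○)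
  ∷ (5 , mk ○ ⊕ ○ ○ ○ ⊖ ⊕ ⊖ ○ ⊕ ○ ⊕ ○ ⊕ ⊖ ○)
  ∷ (2 , mk ○ ⊕ ○ ○ ○ ○ ⊕ ○ ⊕ ⊖ ⊖ ⊕ ○ ⊖ ○ ○)
  ∷ (1 , mk ○ ⊕ ○ ○ ○ ○ ⊕ ○ ⊕ ⊖ ○ ○ ⊕ ⊖ ○ ○)
  ∷ (3 , mk ○ ⊕ ○ ○ ○ ⊕ ⊖ ○ ⊕ ⊖ ○ ⊖ ○ ⊖ ○ ○)
  ∷ [])
template₁₂ neither = expand
  ( (1 , mk ○ ○ ○ ⊕ ⊕ ⊕ ○ ⊖ ○ ⊖ ○ ⊖ ⊕ ⊕ ○ ⊖)
  ∷ (1 , mk ○ ○ ○ ⊕ ⊕ ⊕ ○ ⊖ ○ ⊖ ○ ⊖ ⊕ ⊕ ○ ○)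
  ∷ (11 , mk ○ ○ ⊕ ⊕ ⊕ ⊖ ○ ○ ⊖ ○ ○ ⊕ ⊖ ○ ○ ⊕)
  ∷ [])

template₁₃ : Template
template₁₃ both = expand
  ( (2 , mk ⊕ ⊖ ○ ○ ○ ⊖ ○ ○ ⊖ ○ ⊕ ⊖ ○ ⊕ ○ ○)
  ∷ (2 , mk ⊕ ⊖ ○ ○ ○ ⊖ ○ ⊕ ⊖ ○ ⊕ ⊖ ○ ○ ○ ○)
  ∷ (2 , mk ⊕ ⊖ ○ ○ ○ ⊖ ○ ⊕ ○ ○ ⊕ ⊖ ○ ⊖ ⊕ ○)
  ∷ (1 , mk ⊕ ⊖ ○ ○ ○ ⊖ ⊕ ○ ⊖ ○ ○ ○ ○ ⊕ ○ ○)
  ∷ (2 , mk ⊕ ⊖ ○ ○ ○ ○ ○ ⊕ ○ ⊖ ⊖ ○ ⊕ ⊖ ⊕ ○)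
  ∷ (1 , mk ⊕ ⊖ ○ ○ ○ ○ ⊕ ○ ⊖ ○ ⊖ ○ ○ ⊕ ○ ○)
  ∷ (1 , mk ⊕ ⊖ ○ ○ ○ ○ ⊕ ○ ⊖ ○ ○ ○ ⊕ ⊕ ○ ○)
  ∷ (1 , mk ⊕ ⊖ ○ ○ ○ ○ ⊕ ○ ○ ⊖ ⊖ ○ ○ ○ ⊕ ⊖)
  ∷ (1 , mk ⊕ ⊖ ○ ○ ○ ○ ⊕ ○ ○ ⊖ ⊖ ○ ○ ⊕ ○ ⊖)
  ∷ [])
template₁₃ onlyP = expand
  ( (9 , mk ⊕ ○ ⊖ ⊖ ⊖ ○ ○ ○ ⊕ ○ ⊖ ○ ⊕ ○ ○ ⊕)
  ∷ (4 , mk ⊕ ○ ○ ⊖ ○ ⊖ ○ ⊕ ⊖ ○ ⊕ ⊖ ○ ○ ⊖ ○)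
  ∷ (1 , mk ⊕ ○ ○ ⊖ ○ ○ ⊕ ○ ⊕ ⊖ ⊖ ○ ○ ⊖ ⊕ ○)
  ∷ (6 , mk ⊕ ○ ○ ○ ○ ○ ⊕ ⊖ ⊕ ⊖ ⊖ ○ ○ ○ ⊕ ○)
  ∷ (1 , mk ⊕ ○ ○ ○ ○ ○ ⊕ ○ ⊕ ⊖ ⊖ ○ ○ ⊖ ⊕ ○)
  ∷ (1 , mk ⊕ ○ ○ ○ ○ ○ ⊕ ○ ⊕ ⊖ ⊖ ○ ○ ○ ○ ⊕)
  ∷ (3 , mk ⊕ ○ ⊕ ○ ⊖ ⊖ ○ ⊖ ○ ○ ⊕ ⊖ ○ ○ ⊕ ⊖)
  ∷ (2 , mk ⊕ ○ ⊕ ○ ⊖ ○ ○ ⊖ ○ ○ ⊖ ○ ⊕ ○ ⊕ ⊖)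
  ∷ (1 , mk ⊕ ○ ⊕ ○ ○ ○ ○ ⊖ ○ ⊖ ○ ⊖ ○ ⊕ ○ ⊖)
  ∷ [])
template₁₃ onlyQ = expand
  ( (1 , mk ○ ⊕ ⊖ ⊖ ⊖ ○ ○ ○ ⊕ ○ ○ ○ ⊕ ⊖ ○ ○)
  ∷ (1 , mk ○ ⊕ ⊖ ⊖ ⊖ ○ ⊕ ○ ○ ⊕ ⊖ ○ ○ ○ ⊖ ○)
  ∷ (1 , mk ○ ⊕ ⊖ ⊖ ⊖ ○ ⊕ ○ ○ ⊕ ⊖ ⊕ ○ ⊖ ○ ⊕)
  ∷ (11 , mk ○ ⊕ ⊖ ⊖ ⊖ ○ ⊕ ○ ○ ⊕ ○ ○ ⊕ ⊖ ○ ⊕)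
  ∷ (1 , mk ○ ⊕ ⊖ ○ ○ ○ ⊕ ○ ⊕ ○ ○ ⊕ ⊖ ⊖ ○ ○)
  ∷ (8 , mk ○ ⊕ ○ ○ ○ ⊖ ⊕ ⊖ ○ ⊕ ○ ⊕ ○ ⊕ ⊖ ○)
  ∷ (4 , mk ○ ⊕ ○ ○ ○ ⊕ ⊖ ○ ⊕ ⊖ ○ ⊖ ○ ⊖ ○ ○)
  ∷ (1 , mk ○ ⊕ ○ ○ ○ ⊕ ⊖ ○ ⊕ ⊖ ○ ○ ○ ⊖ ○ ○)
  ∷ [])
template₁₃ neither = expand
  ( (1 , mk ○ ○ ○ ○ ⊕ ⊕ ○ ⊕ ⊖ ○ ○ ⊖ ⊕ ○ ⊖ ○)
  ∷ (1 , mk ○ ○ ○ ⊕ ○ ⊕ ○ ⊖ ⊕ ○ ○ ⊖ ⊕ ○ ⊕ ○)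
  ∷ (1 , mk ○ ○ ○ ⊕ ⊕ ⊕ ○ ⊖ ○ ⊖ ⊖ ○ ⊕ ⊕ ○ ○)
  ∷ (8 , mk ○ ○ ⊕ ⊕ ⊕ ⊖ ○ ⊖ ○ ○ ○ ⊕ ⊖ ○ ⊕ ⊖)
  ∷ (3 , mk ○ ○ ⊕ ⊕ ⊕ ⊖ ○ ○ ⊖ ○ ○ ⊕ ⊖ ○ ○ ⊕)
  ∷ [])

template₁₄ : Template
template₁₄ both = expand
  ( (2 , mk ⊕ ⊖ ○ ○ ○ ⊖ ○ ⊕ ⊖ ○ ⊕ ⊖ ○ ○ ○ ○)
  ∷ (2 , mk ⊕ ⊖ ○ ○ ○ ⊖ ○ ⊕ ○ ○ ⊕ ⊖ ○ ⊖ ⊕ ○)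
  ∷ (2 , mk ⊕ ⊖ ○ ○ ○ ⊖ ⊕ ○ ⊖ ○ ○ ○ ○ ⊕ ○ ○)
  ∷ (2 , mk ⊕ ⊖ ○ ○ ○ ○ ○ ⊕ ○ ⊖ ⊖ ○ ⊕ ⊖ ⊕ ○)
  ∷ (2 , mk ⊕ ⊖ ○ ○ ○ ○ ⊕ ○ ⊖ ○ ⊖ ○ ○ ⊕ ○ ○)
  ∷ (2 , mk ⊕ ⊖ ○ ○ ○ ○ ⊕ ○ ○ ⊖ ⊖ ○ ○ ⊕ ○ ⊖)
  ∷ (1 , mk ⊕ ⊖ ⊕ ○ ○ ○ ○ ○ ⊖ ○ ⊖ ○ ⊕ ⊕ ○ ○)
  ∷ (1 , mk ⊕ ⊖ ⊕ ○ ○ ○ ○ ○ ○ ⊖ ⊖ ○ ⊕ ○ ⊕ ⊖)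
  ∷ [])
template₁₄ onlyP = expand
  ( (9 , mk ⊕ ○ ⊖ ⊖ ⊖ ○ ○ ○ ⊕ ○ ⊖ ○ ⊕ ○ ○ ⊕)
  ∷ (4 , mk ⊕ ○ ○ ⊖ ○ ⊖ ○ ⊕ ⊖ ○ ⊕ ⊖ ○ ○ ⊖ ○)
  ∷ (1 , mk ⊕ ○ ○ ⊖ ○ ○ ⊕ ○ ⊕ ⊖ ⊖ ○ ○ ⊖ ⊕ ○)
  ∷ (1 , mk ⊕ ○ ○ ○ ⊖ ⊖ ○ ⊖ ⊕ ○ ⊕ ⊖ ○ ○ ⊕ ○)
  ∷ (5 , mk ⊕ ○ ○ ○ ○ ○ ⊕ ⊖ ⊕ ⊖ ⊖ ○ ○ ○ ⊕ ○)
  ∷ (1 , mk ⊕ ○ ○ ○ ○ ○ ⊕ ○ ⊕ ⊖ ⊖ ○ ○ ⊖ ⊕ ○)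
  ∷ (1 , mk ⊕ ○ ○ ○ ○ ○ ⊕ ○ ⊕ ⊖ ⊖ ○ ○ ○ ○ ⊕)
  ∷ (3 , mk ⊕ ○ ⊕ ○ ⊖ ⊖ ○ ⊖ ○ ○ ⊕ ⊖ ○ ○ ⊕ ⊖)
  ∷ (1 , mk ⊕ ○ ⊕ ○ ⊖ ○ ○ ⊖ ○ ○ ○ ⊖ ⊕ ○ ⊕ ⊖)
  ∷ (1 , mk ⊕ ○ ⊕ ○ ○ ○ ○ ⊖ ○ ⊖ ○ ⊖ ○ ⊕ ○ ⊖)
  ∷ [])
template₁₄ onlyQ = expand
  ( (1 , mk ○ ⊕ ⊖ ⊖ ⊖ ○ ⊕ ○ ○ ⊕ ⊖ ⊕ ○ ○ ⊖ ○)
  ∷ (11 , mk ○ ⊕ ⊖ ⊖ ⊖ ○ ⊕ ○ ○ ⊕ ○ ○ ⊕ ⊖ ○ ⊕)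
  ∷ (1 , mk ○ ⊕ ⊖ ○ ○ ○ ⊕ ○ ⊕ ○ ○ ○ ⊕ ⊖ ○ ○)
  ∷ (1 , mk ○ ⊕ ○ ⊖ ○ ⊕ ○ ○ ⊕ ⊖ ⊖ ○ ⊕ ⊖ ○ ○)
  ∷ (1 , mk ○ ⊕ ○ ⊖ ○ ⊕ ○ ○ ⊕ ○ ○ ⊖ ⊕ ⊖ ○ ○)
  ∷ (2 , mk ○ ⊕ ○ ○ ⊖ ⊖ ⊕ ⊖ ○ ⊕ ○ ⊕ ○ ⊕ ⊖ ○)
  ∷ (6 , mk ○ ⊕ ○ ○ ○ ⊖ ⊕ ⊖ ○ ⊕ ○ ⊕ ○ ⊕ ⊖ ○)
  ∷ (4 , mk ○ ⊕ ○ ○ ○ ⊕ ⊖ ○ ⊕ ⊖ ○ ⊖ ○ ⊖ ○ ○)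
  ∷ [])
template₁₄ neither = expand
  ( (1 , mk ○ ○ ○ ○ ○ ○ ⊕ ⊖ ○ ⊕ ⊖ ⊕ ○ ⊕ ○ ○)
  ∷ (1 , mk ○ ○ ○ ○ ⊕ ⊕ ○ ⊕ ⊖ ○ ○ ⊖ ⊕ ○ ⊖ ○)
  ∷ (1 , mk ○ ○ ○ ⊕ ○ ⊕ ○ ⊖ ⊕ ⊖ ⊖ ○ ○ ○ ⊕ ○)
  ∷ (9 , mk ○ ○ ⊕ ⊕ ⊕ ⊖ ○ ⊖ ○ ○ ○ ⊕ ⊖ ○ ⊕ ⊖)
  ∷ (2 , mk ○ ○ ⊕ ⊕ ⊕ ⊖ ○ ○ ⊖ ○ ○ ⊕ ⊖ ○ ○ ⊕)
  ∷ (1 , mk ○ ○ ⊕ ⊕ ⊕ ○ ⊖ ○ ⊖ ○ ○ ○ ⊕ ○ ○ ⊕)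
  ∷ [])

valid₁₂ : ValidTemplate 12 template₁₂
valid₁₂ = record
  { lengths  = λ { both → refl ; onlyP → refl ; onlyQ → refl ; neither → refl }
  ; patterns = λ { both → tt ; onlyP → tt ; onlyQ → tt ; neither → tt }
  ; sizes    = tt
  ; overlaps = tt
  }

valid₁₃ : ValidTemplate 13 template₁₃
valid₁₃ = record
  { lengths  = λ { both → refl ; onlyP → refl ; onlyQ → refl ; neither → refl }
  ; patterns = λ { both → tt ; onlyP → tt ; onlyQ → tt ; neither → tt }
  ; sizes    = tt
  ; overlaps = tt
  }

valid₁₄ : ValidTemplate 14 template₁₄
valid₁₄ = record
  { lengths  = λ { both → refl ; onlyP → refl ; onlyQ → refl ; neither → refl }
  ; patterns = λ { both → tt ; onlyP → tt ; onlyQ → tt ; neither → tt }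
  ; sizes    = tt
  ; overlaps = tt
  }

templateFor : ∀ {i} → Overlap i → Σ Template (ValidTemplate i)
templateFor twelve   = template₁₂ , valid₁₂
templateFor thirteen = template₁₃ , valid₁₃
templateFor fourteen = template₁₄ , valid₁₄

oriented : ∀ {n} {G : SG n} (𝒞 : SignedColouring G) {a b p q σ} → SEdge G a b σ →
           (p ≡ a × q ≡ b) ⊎ (p ≡ b × q ≡ a) →
           Fits σ (SignedColouring.colour 𝒞 p) (SignedColouring.colour 𝒞 q)
oriented 𝒞 ab (inj₁ (refl , refl)) = fits-SEdge 𝒞 ab
oriented 𝒞 ab (inj₂ (refl , refl)) = Fits-sym (fits-SEdge 𝒞 ab)

built⇒signedColouring : ∀ {n G Fs} → Built n G Fs → SignedColouring G
built⇒signedColouring base       = signedColouringK3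
built⇒signedColouring (perm b _) = built⇒signedColouring b
built⇒signedColouring (rot b)    = built⇒signedColouring b
built⇒signedColouring (op1 {G = G} s₁ s₂ s₃ sₙ b negative x₁x₂ x₂x₃ x₁x₃) = record
  { colour  = colour′
  ; card≡41 = card′
  ; fits    = fits-apex fits₁ ∷ fits-apex fits₂ ∷ fits-apex fits₃ ∷
              map⁺ (All.map fits-old (SignedColouring.fits 𝒞))
  }
  where
  𝒞 : SignedColouring G
  𝒞 = built⇒signedColouring b
  open NewVertex 𝒞 s₁ s₂ s₃ sₙ negative x₁x₂ x₂x₃ x₁x₃
built⇒signedColouring (op2 {G = G} {σab = σ} p q _ sw b ab pq switch-uv) = record
  { colour  = colour′
  ; card≡41 = card′
  ; fits    = ++⁺ (map⁺ (All.tabulate fits-copy)) (map⁺ (All.map fits-old (SignedColouring.fits 𝒞)))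
  }
  where
  𝒞 : SignedColouring G
  𝒞 = built⇒signedColouring b
  fits-pq : Fits σ (SignedColouring.colour 𝒞 p) (SignedColouring.colour 𝒞 q)
  fits-pq = oriented 𝒞 ab pq
  open Gadget 𝒞 p q sw fits-pq switch-uv (proj₁ (templateFor (proj₂ fits-pq)))
                                         (proj₂ (templateFor (proj₂ fits-pq)))

theorem4 : (n : ℕ) (G : SG n) (Fs : List (List (Fin n))) →
    Built n G Fs → BalancedColoring 83 41 G
theorem4 n G Fs built = signedColouring⇒balancedColoring (built⇒signedColouring built)
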